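{- Let $\mathbf{L}\in\{\mathbf{K_n},\mathbf{KD_n}\}$. Let $\Gamma,\Delta$ be finite multisets of $\mathcal{L}^1$-formulas. For every propositional variable $p$ there exists a formula $\mathcal{A}_p(\Gamma;\Delta)$ such that: (i) $\mathsf{V}(\mathcal{A}_p(\Gamma;\Delta))\subseteq\mathsf{V}(\Gamma\cup\Delta)\setminus\{p\}$; (ii) $\mathsf{G}(\mathbf{L})\vdash\Gamma,\mathcal{A}_p(\Gamma;\Delta)\Rightarrow\Delta$; (iii) for all finite multisets $\Pi,\Lambda$ of formulas with $p\notin\mathsf{V}(\Pi\cup\Lambda)$ and $\mathsf{G}(\mathbf{L})\vdash\Pi,\Gamma\Rightarrow\Delta,\Lambda$, we have $\mathsf{G}(\mathbf{L})\vdash\Pi\Rightarrow\mathcal{A}_p(\Gamma;\Delta),\Lambda$.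
   Context: Fix a finite set $\mathsf{Agt}$ of agents and a countable set $\mathsf{Prop}$ of propositional variables. Formulas of $\mathcal{L}^1$: $A::=p\mid\bot\mid A\wedge A\mid A\vee A\mid A\rightarrow A\mid\neg A\mid\Box_i A$ ($p\in\mathsf{Prop}$, $i\in\mathsf{Agt}$). An outmost-boxed formula is one of the form $\Box_j B$. $\Box_i\Gamma=\{\Box_iA:A\in\Gamma\}$. $\mathsf{V}(\cdot)$ is the set of propositional variables occurring. A sequent $\Gamma\Rightarrow\Delta$ is a pair of finite multisets of formulas; commas denote multiset union. $\mathsf{G}(\mathbf{K_n})$: initial sequents $\Gamma,p\Rightarrow p,\Delta$ and $\bot,\Gamma\Rightarrow\Delta$; logical rules $(R\wedge)$: $\Gamma\Rightarrow\Delta,A_1$ and $\Gamma\Rightarrow\Delta,A_2$ / $\Gamma\Rightarrow\Delta,A_1\wedge A_2$; $(L\wedge)$: $A_1,A_2,\Gamma\Rightarrow\Delta$ / $A_1\wedge A_2,\Gamma\Rightarrow\Delta$; $(R\vee)$: $\Gamma\Rightarrow\Delta,A_1,A_2$ / $\Gamma\Rightarrow\Delta,A_1\vee A_2$; $(L\vee)$: $A_1,\Gamma\Rightarrow\Delta$ and $A_2,\Gamma\Rightarrow\Delta$ / $A_1\vee A_2,\Gamma\Rightarrow\Delta$; $(R\rightarrow)$: $A_1,\Gamma\Rightarrow\Delta,A_2$ / $\Gamma\Rightarrow\Delta,A_1\rightarrow A_2$; $(L\rightarrow)$: $\Gamma\Rightarrow\Delta,A_1$ and $A_2,\Gamma\Rightarrow\Delta$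 / $A_1\rightarrow A_2,\Gamma\Rightarrow\Delta$; $(R\neg)$: $A,\Gamma\Rightarrow\Delta$ / $\Gamma\Rightarrow\Delta,\neg A$; $(L\neg)$: $\Gamma\Rightarrow\Delta,A$ / $\neg A,\Gamma\Rightarrow\Delta$. Modal rule $(\Box_{Kn})$: from $\Gamma\Rightarrow A$ infer $\Sigma,\Box_i\Gamma\Rightarrow\Box_iA,\Omega$, where members of $\Sigma$ are propositional variables, $\bot$, or formulas $\Box_jB$ with $j\neq i$, and members of $\Omega$ are propositional variables, $\bot$, or outmost-boxed formulas. $\mathsf{G}(\mathbf{KD_n})$ adds $(\Box_{Dn})$: from $\Gamma\Rightarrow$ (empty succedent), $\Gamma\neq\emptyset$, infer $\Sigma,\Box_i\Gamma\Rightarrow\Omega$, with $\Sigma,\Omega$ restricted as in $(\Box_{Kn})$. $\mathsf{G}(\mathbf{L})\vdash S$ means $S$ is the root of a finite tree built from initial sequents by the rules. -}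

module Defs where

open import Data.Nat using (ℕ)
open import Data.Fin using (Fin)
open import Data.List using (List; []; _∷_; _++_; map; concatMap)
open import Data.List.Relation.Unary.All using (All)
open import Data.List.Relation.Binary.Permutation.Propositional using (_↭_)
open import Data.List.Membership.Propositional using (_∈_)
open import Data.Empty using (⊥)
open import Data.Unit using (⊤)
open import Relation.Binary.PropositionalEquality using (_≡_; _≢_)
open import Relation.Nullary using (¬_)
open import Data.Product using (_×_)

data Fm (k : ℕ) : Set where
  var  : ℕ → Fm k
  ⊥′   : Fm k
  _∧′_ : Fm k → Fm k → Fm k
  _∨′_ : Fm k → Fm k → Fm k
  _⇒′_ : Fm k → Fm k → Fm k
  ¬′_  : Fm k → Fm k
  □    : Fin k → Fm k → Fm k

V : ∀ {k} → Fm k → List ℕ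
V (var p)   = p ∷ []
V ⊥′        = []
V (A ∧′ B)  = V A ++ V B
V (A ∨′ B)  = V A ++ V B
V (A ⇒′ B)  = V A ++ V B
V (¬′ A)    = V A
V (□ i A)   = V A

Vs : ∀ {k} → List (Fm k) → List ℕ
Vs = concatMap V

SigmaOK : ∀ {k} → Fin k → Fm k → Set
SigmaOK i (var _) = ⊤
SigmaOK i ⊥′      = ⊤
SigmaOK i (□ j _) = j ≢ i
SigmaOK i _       = ⊥

OmegaOK : ∀ {k} → Fm k → Set
OmegaOK (var _) = ⊤
OmegaOK ⊥′      = ⊤
OmegaOK (□ _ _) = ⊤
OmegaOK _       = ⊥

data Logic : Set where
  Kn KDn : Logic

-- Sequents Γ ⇒ Δ are pairs of finite multisets, represented as lists
-- taken up to permutation (rule `perm`), so positions of principal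
-- formulas are immaterial.
data G {k : ℕ} (L : Logic) : List (Fm k) → List (Fm k) → Set where
  perm  : ∀ {Γ Γ' Δ Δ'} → Γ ↭ Γ' → Δ ↭ Δ' → G L Γ Δ → G L Γ' Δ'
  ax    : ∀ {Γ Δ} p → G L (var p ∷ Γ) (var p ∷ Δ)
  ax⊥   : ∀ {Γ Δ} → G L (⊥′ ∷ Γ) Δ
  R∧    : ∀ {Γ Δ A B} → G L Γ (A ∷ Δ) → G L Γ (B ∷ Δ) → G L Γ ((A ∧′ B) ∷ Δ)
  L∧    : ∀ {Γ Δ A B} → G L (A ∷ B ∷ Γ) Δ → G L ((A ∧′ B) ∷ Γ) Δ
  R∨    : ∀ {Γ Δ A B} → G L Γ (A ∷ B ∷ Δ) → G L Γ ((A ∨′ B) ∷ Δ)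
  L∨    : ∀ {Γ Δ A B} → G L (A ∷ Γ) Δ → G L (B ∷ Γ) Δ → G L ((A ∨′ B) ∷ Γ) Δ
  R⇒    : ∀ {Γ Δ A B} → G L (A ∷ Γ) (B ∷ Δ) → G L Γ ((A ⇒′ B) ∷ Δ)
  L⇒    : ∀ {Γ Δ A B} → G L Γ (A ∷ Δ) → G L (B ∷ Γ) Δ → G L ((A ⇒′ B) ∷ Γ) Δ
  R¬    : ∀ {Γ Δ A} → G L (A ∷ Γ) Δ → G L Γ ((¬′ A) ∷ Δ)
  L¬    : ∀ {Γ Δ A} → G L Γ (A ∷ Δ) → G L ((¬′ A) ∷ Γ) Δ
  □K    : ∀ {Γ A Σ Ω} (i : Fin k) → All (SigmaOK i) Σ → All OmegaOK Ω →
          G L Γ (A ∷ []) → G L (Σ ++ map (□ i) Γ) (□ i A ∷ Ω)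
  □D    : ∀ {Γ Σ Ω} (i : Fin k) → L ≡ KDn → Γ ≢ [] →
          All (SigmaOK i) Σ → All OmegaOK Ω →
          G L Γ [] → G L (Σ ++ map (□ i) Γ) Ω

module Submission where

-- The interpolant of Γ ⇒ Δ is computed by backward proof search: it is the disjunction, over
-- every way in which the last rule of a derivation of Π , Γ ⇒ Δ , Λ can act on Γ ⇒ Δ, of a
-- formula that Π ⇒ Λ must prove in that case.  An initial sequent contributes ¬q, q or ⊤; a
-- propositional rule with principal formula in Γ ⇒ Δ contributes the conjunction of the
-- interpolants of its premises; the modal rule with principal formula □ᵢC in Δ contributes □ᵢ of
-- the interpolant of boxesᵢ(Γ) ⇒ C; and a modal rule for agent i whose principal formula (if
-- any) lies in Λ contributes ◇ᵢ of the interpolant of boxesᵢ(Γ) ⇒ (when boxesᵢ(Γ) is empty such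
-- a rule acts on Π ⇒ Λ alone).  Each disjunct D uses only variables of Γ ⇒ Δ other than p and
-- satisfies D , Γ ⇒ Δ, which gives (i) and (ii).  For (iii) one inducts on the derivation of
-- Π , Γ ⇒ Δ , Λ: a rule acting on Π ⇒ Λ is re-applied with the interpolant carried along in the
-- succedent, and a rule acting on Γ ⇒ Δ yields a derivation of Π ⇒ Λ with the matching disjunct.
-- Every premise considered is smaller than its conclusion, so the search terminates.

open import Defs
open import Data.Empty using (⊥-elim)
open import Data.Fin using (Fin; _≟_)
open import Data.List using (List; []; _∷_; _++_; map; concatMap; mapMaybe; allFin)
open import Data.List.Membership.Propositional using (_∈_; _∉_)
open import Data.List.Membership.Propositional.Properties
  using (∈-++⁺ˡ; ∈-++⁺ʳ; ∈-++⁻; ∈-map⁺; ∈-map⁻; ∈-concatMap⁺; ∈-∃++; ∈-allFin)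
import Data.List.Properties as List
open import Data.List.Relation.Binary.Permutation.Propositional
open import Data.List.Relation.Binary.Permutation.Propositional.Properties
  using (∈-resp-↭; shift; shifts; drop-∷; ++⁺; ++⁺ˡ; ++⁺ʳ; ++-comm; map⁺; mapMaybe-↭; ↭-empty-inv)
open import Data.List.Relation.Binary.Subset.Propositional using (_⊆_)
import Data.List.Relation.Binary.Subset.Propositional.Properties as ⊆
open import Data.List.Relation.Unary.All as All using (All; []; _∷_)
import Data.List.Relation.Unary.All.Properties as All
open import Data.List.Relation.Unary.Any as Any using (here; there; any?)
open import Data.Maybe using (Maybe; just; nothing)
open import Data.Nat using (ℕ; zero; suc; _+_; _<_; _≤_; z≤n; s≤s)
import Data.Nat as ℕ
open import Data.Nat.ListAction using (sum)
open import Data.Nat.ListAction.Properties using (sum-++; sum-↭)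
open import Data.Nat.Properties
  using (module ≤-Reasoning; n<1+n; n≤1+n; m≤m+n; m≤n+m; ≤-reflexive; ≤-trans; <-≤-trans; ≤-pred;
         +-identityʳ; +-monoʳ-≤; +-monoˡ-<)
open import Data.Product using (Σ; ∃; _×_; _,_; proj₁; proj₂; uncurry)
open import Data.Sum using (_⊎_; inj₁; inj₂)
open import Data.Unit using (tt)
open import Function using (_∘_)
open import Relation.Binary.PropositionalEquality as ≡ using (_≡_; _≢_; refl; cong)
open import Relation.Nullary using (Dec; yes; no)
import Relation.Nullary.Decidable as Dec
open import Relation.Nullary.Decidable using (¬?)

module _ {A : Set} where

  ↭⇒∈ : ∀ {x : A} {xs ys} → xs ↭ x ∷ ys → x ∈ xs
  ↭⇒∈ σ = ∈-resp-↭ (↭-sym σ) (here refl)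

  ∈⇒↭ : ∀ {x : A} {xs} → x ∈ xs → ∃ λ ys → xs ↭ x ∷ ys
  ∈⇒↭ x∈xs with ys , zs , refl ← ∈-∃++ x∈xs = ys ++ zs , shift _ ys zs

  joinˡ : ∀ E Γ Π {X : List A} → X ↭ Γ ++ Π → E ++ X ↭ (E ++ Γ) ++ Π
  joinˡ E Γ Π σ = trans (++⁺ˡ E σ) (↭-reflexive (≡.sym (List.++-assoc E Γ Π)))

  joinʳ : ∀ E Γ Π {X : List A} → X ↭ Γ ++ Π → E ++ X ↭ Γ ++ E ++ Π
  joinʳ E Γ Π σ = trans (++⁺ˡ E σ) (shifts E Γ)

  data Split (x : A) (X Γ Π : List A) : Set where
    inˡ : ∀ Γ₁ → Γ ↭ x ∷ Γ₁ → X ↭ Γ₁ ++ Π → Split x X Γ Π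
    inʳ : ∀ Π₁ → Π ↭ x ∷ Π₁ → X ↭ Γ ++ Π₁ → Split x X Γ Π

  split : ∀ Γ Π {x X} → x ∷ X ↭ Γ ++ Π → Split x X Γ Π
  split Γ Π σ with ∈-++⁻ Γ (↭⇒∈ (↭-sym σ))
  ... | inj₁ x∈Γ with Γ₁ , γσ ← ∈⇒↭ x∈Γ = inˡ Γ₁ γσ (drop-∷ (trans σ (++⁺ʳ Π γσ)))
  ... | inj₂ x∈Π with Π₁ , πσ ← ∈⇒↭ x∈Π = inʳ Π₁ πσ (drop-∷ (trans σ (trans (++⁺ˡ Γ πσ) (shift _ Γ Π₁))))

  picks : List A → List (A × List A)
  picks []       = []
  picks (x ∷ xs) = (x , xs) ∷ map (λ (y , ys) → y , x ∷ ys) (picks xs)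

  picks-↭ : ∀ {x r} xs → (x , r) ∈ picks xs → xs ↭ x ∷ r
  picks-↭ (y ∷ xs) (here refl) = refl
  picks-↭ (y ∷ xs) (there m) with _ , m′ , refl ← ∈-map⁻ _ m = trans (prep y (picks-↭ xs m′)) (swap _ _ refl)

  ∈⇒picks : ∀ {x} xs → x ∈ xs → ∃ λ r → (x , r) ∈ picks xs
  ∈⇒picks (y ∷ xs) (here refl) = xs , here refl
  ∈⇒picks (y ∷ xs) (there m) with r , m′ ← ∈⇒picks xs m = y ∷ r , there (∈-map⁺ _ m′)

  ↭⇒picks : ∀ {x xs ys} → xs ↭ x ∷ ys → ∃ λ r → (x , r) ∈ picks xs × r ↭ ys
  ↭⇒picks {xs = xs} σ with r , m ← ∈⇒picks xs (↭⇒∈ σ) = r , m , drop-∷ (trans (↭-sym (picks-↭ xs m)) σ)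

  empty? : (xs : List A) → xs ≡ [] ⊎ xs ≢ []
  empty? []      = inj₁ refl
  empty? (_ ∷ _) = inj₂ λ ()

  _if_ : ∀ {P : Set} → A → Dec P → List A
  x if yes _ = x ∷ []
  x if no _  = []

  if-∈ : ∀ {P : Set} {x} (d : Dec P) → P → x ∈ (x if d)
  if-∈ (yes _) _  = here refl
  if-∈ (no ¬p) p = ⊥-elim (¬p p)

  if-All : ∀ {P : Set} {Q : A → Set} {x} (d : Dec P) → (P → Q x) → All Q (x if d)
  if-All (yes p) f = f p ∷ []
  if-All (no _)  _ = []

  all-concatMap : ∀ {B : Set} {Q : B → Set} (f : A → List B) {xs} →
                  (∀ {x} → x ∈ xs → All Q (f x)) → All Q (concatMap f xs)
  all-concatMap f h = All.concat⁺ (All.map⁺ (All.tabulate h))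

  ∈-concatMap : ∀ {B : Set} (f : A → List B) {x xs y} → x ∈ xs → y ∈ f x → y ∈ concatMap f xs
  ∈-concatMap f x∈xs y∈fx = ∈-concatMap⁺ f (Any.map (λ { refl → y∈fx }) x∈xs)

-- Weakening

module _ {k : ℕ} {L : Logic} where

  -- Variables, ⊥ and boxed formulas may be side formulas of the modal rules and are pushed up
  -- the derivation; compound formulas are weakened in by their own rules, reducing to that case.
  mutual
    weakenˡ : ∀ (A : Fm k) {Γ Δ} → G L Γ Δ → G L (A ∷ Γ) Δ
    weakenˡ (var q)    = weakenˡ-side (var q) tt
    weakenˡ ⊥′         = weakenˡ-side ⊥′ tt
    weakenˡ (□ i B)    = weakenˡ-side (□ i B) tt
    weakenˡ (B ∧′ C) d = L∧ (weakenˡ B (weakenˡ C d))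
    weakenˡ (B ∨′ C) d = L∨ (weakenˡ B d) (weakenˡ C d)
    weakenˡ (B ⇒′ C) d = L⇒ (weakenʳ B d) (weakenˡ C d)
    weakenˡ (¬′ B)   d = L¬ (weakenʳ B d)

    weakenʳ : ∀ (A : Fm k) {Γ Δ} → G L Γ Δ → G L Γ (A ∷ Δ)
    weakenʳ (var q)    = weakenʳ-side (var q) tt
    weakenʳ ⊥′         = weakenʳ-side ⊥′ tt
    weakenʳ (□ i B)    = weakenʳ-side (□ i B) tt
    weakenʳ (B ∧′ C) d = R∧ (weakenʳ B d) (weakenʳ C d)
    weakenʳ (B ∨′ C) d = R∨ (weakenʳ B (weakenʳ C d))
    weakenʳ (B ⇒′ C) d = R⇒ (weakenˡ B (weakenʳ C d))
    weakenʳ (¬′ B)   d = R¬ (weakenˡ B d)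

    weakenˡ-side : ∀ (A : Fm k) → OmegaOK A → ∀ {Γ Δ} → G L Γ Δ → G L (A ∷ Γ) Δ
    weakenˡ-side (□ j B) _ (□K i sΣ oΩ d) with j ≟ i
    ... | yes refl = perm (shift _ _ _) refl (□K i sΣ oΩ (weakenˡ B d))
    ... | no j≢i   = □K i (j≢i ∷ sΣ) oΩ d
    weakenˡ-side (□ j B) _ (□D i e Θ≢[] sΣ oΩ d) with j ≟ i
    ... | yes refl = perm (shift _ _ _) refl (□D i e (λ ()) sΣ oΩ (weakenˡ B d))
    ... | no j≢i   = □D i e Θ≢[] (j≢i ∷ sΣ) oΩ d
    weakenˡ-side (var q) _ (□K i sΣ oΩ d)        = □K i (tt ∷ sΣ) oΩ d
    weakenˡ-side (var q) _ (□D i e Θ≢[] sΣ oΩ d) = □D i e Θ≢[] (tt ∷ sΣ) oΩ d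
    weakenˡ-side ⊥′      _ (□K i sΣ oΩ d)        = □K i (tt ∷ sΣ) oΩ d
    weakenˡ-side ⊥′      _ (□D i e Θ≢[] sΣ oΩ d) = □D i e Θ≢[] (tt ∷ sΣ) oΩ d
    weakenˡ-side A a (perm σ τ d) = perm (prep A σ) τ (weakenˡ-side A a d)
    weakenˡ-side A a (ax q)       = perm (swap _ _ refl) refl (ax q)
    weakenˡ-side A a ax⊥          = perm (swap _ _ refl) refl ax⊥
    weakenˡ-side A a (R∧ d e)     = R∧ (weakenˡ-side A a d) (weakenˡ-side A a e)
    weakenˡ-side A a (L∧ d)       =
      perm (swap _ _ refl) refl (L∧ (perm (↭-sym (shift A (_ ∷ _ ∷ []) _)) refl (weakenˡ-side A a d)))
    weakenˡ-side A a (R∨ d)       = R∨ (weakenˡ-side A a d)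
    weakenˡ-side A a (L∨ d e)     = perm (swap _ _ refl) refl
      (L∨ (perm (swap _ _ refl) refl (weakenˡ-side A a d)) (perm (swap _ _ refl) refl (weakenˡ-side A a e)))
    weakenˡ-side A a (R⇒ d)       = R⇒ (perm (swap _ _ refl) refl (weakenˡ-side A a d))
    weakenˡ-side A a (L⇒ d e)     =
      perm (swap _ _ refl) refl (L⇒ (weakenˡ-side A a d) (perm (swap _ _ refl) refl (weakenˡ-side A a e)))
    weakenˡ-side A a (R¬ d)       = R¬ (perm (swap _ _ refl) refl (weakenˡ-side A a d))
    weakenˡ-side A a (L¬ d)       = perm (swap _ _ refl) refl (L¬ (weakenˡ-side A a d))

    weakenʳ-side : ∀ (A : Fm k) → OmegaOK A → ∀ {Γ Δ} → G L Γ Δ → G L Γ (A ∷ Δ)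
    weakenʳ-side A a (perm σ τ d) = perm σ (prep A τ) (weakenʳ-side A a d)
    weakenʳ-side A a (ax q)       = perm refl (swap _ _ refl) (ax q)
    weakenʳ-side A a ax⊥          = ax⊥
    weakenʳ-side A a (R∧ d e)     = perm refl (swap _ _ refl)
      (R∧ (perm refl (swap _ _ refl) (weakenʳ-side A a d)) (perm refl (swap _ _ refl) (weakenʳ-side A a e)))
    weakenʳ-side A a (L∧ d)       = L∧ (weakenʳ-side A a d)
    weakenʳ-side A a (R∨ d)       =
      perm refl (swap _ _ refl) (R∨ (perm refl (↭-sym (shift A (_ ∷ _ ∷ []) _)) (weakenʳ-side A a d)))
    weakenʳ-side A a (L∨ d e)     = L∨ (weakenʳ-side A a d) (weakenʳ-side A a e)
    weakenʳ-side A a (R⇒ d)       =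
      perm refl (swap _ _ refl) (R⇒ (perm refl (swap _ _ refl) (weakenʳ-side A a d)))
    weakenʳ-side A a (L⇒ d e)     = L⇒ (perm refl (swap _ _ refl) (weakenʳ-side A a d)) (weakenʳ-side A a e)
    weakenʳ-side A a (R¬ d)       = perm refl (swap _ _ refl) (R¬ (weakenʳ-side A a d))
    weakenʳ-side A a (L¬ d)       = L¬ (perm refl (swap _ _ refl) (weakenʳ-side A a d))
    weakenʳ-side A a (□K i sΣ oΩ d)        = perm refl (swap _ _ refl) (□K i sΣ (a ∷ oΩ) d)
    weakenʳ-side A a (□D i e Θ≢[] sΣ oΩ d) = □D i e Θ≢[] sΣ (a ∷ oΩ) d

  weaken : ∀ (W Z : List (Fm k)) {Γ Δ Γ′ Δ′} → G L Γ Δ → W ++ Γ ↭ Γ′ → Z ++ Δ ↭ Δ′ → G L Γ′ Δ′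
  weaken W Z d σ τ = perm σ τ (weakenˡ* W (weakenʳ* Z d))
    where
    weakenˡ* : ∀ W {Γ Δ} → G L Γ Δ → G L (W ++ Γ) Δ
    weakenˡ* []      d = d
    weakenˡ* (A ∷ W) d = weakenˡ A (weakenˡ* W d)
    weakenʳ* : ∀ Z {Γ Δ} → G L Γ Δ → G L Γ (Z ++ Δ)
    weakenʳ* []      d = d
    weakenʳ* (A ∷ Z) d = weakenʳ A (weakenʳ* Z d)

  initial : ∀ {q} {Γ Δ : List (Fm k)} → var q ∈ Γ → var q ∈ Δ → G L Γ Δ
  initial q∈Γ q∈Δ with _ , γσ ← ∈⇒↭ q∈Γ | _ , δσ ← ∈⇒↭ q∈Δ = perm (↭-sym γσ) (↭-sym δσ) (ax _)

  falsum : ∀ {Γ Δ : List (Fm k)} → ⊥′ ∈ Γ → G L Γ Δ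
  falsum ⊥∈Γ with _ , γσ ← ∈⇒↭ ⊥∈Γ = perm (↭-sym γσ) refl ax⊥

-- Formulas, their size and their variables

module _ {k : ℕ} where

  ⊤′ : Fm k
  ⊤′ = ¬′ ⊥′

  ◇ : Fin k → Fm k → Fm k
  ◇ i A = ¬′ □ i (¬′ A)

  ⋀ ⋁ : List (Fm k) → Fm k
  ⋀ []       = ⊤′
  ⋀ (A ∷ As) = A ∧′ ⋀ As
  ⋁ []       = ⊥′
  ⋁ (A ∷ As) = A ∨′ ⋁ As

  ⋀ʳ : ∀ {L As Γ Δ} → All (λ A → G L Γ (A ∷ Δ)) As → G L Γ (⋀ As ∷ Δ)
  ⋀ʳ []       = R¬ ax⊥
  ⋀ʳ (d ∷ ds) = R∧ d (⋀ʳ ds)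

  ⋀ˡ : ∀ {L A As Γ Δ} → A ∈ As → G L (A ∷ Γ) Δ → G L (⋀ As ∷ Γ) Δ
  ⋀ˡ {As = _ ∷ As} (here refl) d = L∧ (perm (swap _ _ refl) refl (weakenˡ (⋀ As) d))
  ⋀ˡ {As = A ∷ _}  (there A∈) d  = L∧ (weakenˡ A (⋀ˡ A∈ d))

  ⋁ʳ : ∀ {L A As Γ Δ} → A ∈ As → G L Γ (A ∷ Δ) → G L Γ (⋁ As ∷ Δ)
  ⋁ʳ {As = _ ∷ As} (here refl) d = R∨ (perm refl (swap _ _ refl) (weakenʳ (⋁ As) d))
  ⋁ʳ {As = A ∷ _}  (there A∈) d  = R∨ (weakenʳ A (⋁ʳ A∈ d))

  ⋁ˡ : ∀ {L As Γ Δ} → All (λ A → G L (A ∷ Γ) Δ) As → G L (⋁ As ∷ Γ) Δ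
  ⋁ˡ []       = ax⊥
  ⋁ˡ (d ∷ ds) = L∨ d (⋁ˡ ds)

  V-⋀ : ∀ {P : ℕ → Set} {As} → All (All P ∘ V) As → All P (V (⋀ As))
  V-⋀ []       = []
  V-⋀ (a ∷ as) = All.++⁺ a (V-⋀ as)

  V-⋁ : ∀ {P : ℕ → Set} {As} → All (All P ∘ V) As → All P (V (⋁ As))
  V-⋁ []       = []
  V-⋁ (a ∷ as) = All.++⁺ a (V-⋁ as)

  var≟ : ∀ q (F : Fm k) → Dec (var q ≡ F)
  var≟ q (var r)  = Dec.map′ (cong var) (λ { refl → refl }) (q ℕ.≟ r)
  var≟ q ⊥′       = no λ ()
  var≟ q (_ ∧′ _) = no λ ()
  var≟ q (_ ∨′ _) = no λ ()
  var≟ q (_ ⇒′ _) = no λ ()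
  var≟ q (¬′ _)   = no λ ()
  var≟ q (□ _ _)  = no λ ()

  size : Fm k → ℕ
  size (var _)  = 1
  size ⊥′       = 1
  size (A ∧′ B) = suc (size A + size B)
  size (A ∨′ B) = suc (size A + size B)
  size (A ⇒′ B) = suc (size A + size B)
  size (¬′ A)   = suc (size A)
  size (□ _ A)  = suc (size A)

  weight : List (Fm k) → ℕ
  weight Γ = sum (map size Γ)

  weight-++ : ∀ Γ Δ → weight (Γ ++ Δ) ≡ weight Γ + weight Δ
  weight-++ Γ Δ = ≡.trans (cong sum (List.map-++ size Γ Δ)) (sum-++ (map size Γ) (map size Δ))

  weight-↭ : ∀ {Γ Δ} → Γ ↭ Δ → weight Γ ≡ weight Δ
  weight-↭ σ = sum-↭ (map⁺ size σ)

  V⊆Vs : ∀ {F : Fm k} {Γ} → F ∈ Γ → V F ⊆ Vs Γ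
  V⊆Vs F∈Γ q∈F = ∈-concatMap⁺ V (Any.map (λ { refl → q∈F }) F∈Γ)

  Vs-mono : ∀ {Γ Δ : List (Fm k)} → Γ ⊆ Δ → Vs Γ ⊆ Vs Δ
  Vs-mono = ⊆.concatMap⁺ V

  Vs-↭ : ∀ {Γ Δ : List (Fm k)} → Γ ↭ Δ → Vs Γ ⊆ Vs Δ
  Vs-↭ = Vs-mono ∘ ⊆.⊆-reflexive-↭

  Vs-++ : ∀ (Γ Δ : List (Fm k)) → Vs (Γ ++ Δ) ≡ Vs Γ ++ Vs Δ
  Vs-++ = List.concatMap-++ V

-- Boxed formulas and the modal rules

module _ {k : ℕ} where

  data BoxView (i : Fin k) : Fm k → Set where
    boxed   : ∀ A → BoxView i (□ i A)
    unboxed : ∀ {F} → (∀ A → F ≢ □ i A) → BoxView i F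

  boxView : ∀ i F → BoxView i F
  boxView i (□ j A) with j ≟ i
  ... | yes refl = boxed A
  ... | no j≢i   = unboxed λ { _ refl → j≢i refl }
  boxView i (var _)  = unboxed λ _ ()
  boxView i ⊥′       = unboxed λ _ ()
  boxView i (_ ∧′ _) = unboxed λ _ ()
  boxView i (_ ∨′ _) = unboxed λ _ ()
  boxView i (_ ⇒′ _) = unboxed λ _ ()
  boxView i (¬′ _)   = unboxed λ _ ()

  unbox : Fin k → Fm k → Maybe (Fm k)
  unbox i F with boxView i F
  ... | boxed A   = just A
  ... | unboxed _ = nothing

  boxes : Fin k → List (Fm k) → List (Fm k)
  boxes i = mapMaybe (unbox i)

  boxes-split : ∀ i Γ → ∃ λ W → Γ ↭ W ++ map (□ i) (boxes i Γ)
  boxes-split i [] = [] , refl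
  boxes-split i (F ∷ Γ) with boxView i F | boxes-split i Γ
  ... | boxed A   | W , σ = W , trans (prep _ σ) (↭-sym (shift _ W _))
  ... | unboxed _ | W , σ = F ∷ W , prep F σ

  boxes-modal-conclusion : ∀ i {Σ Θ} → All (SigmaOK i) Σ → boxes i (Σ ++ map (□ i) Θ) ≡ Θ
  boxes-modal-conclusion i {F ∷ Σ} (s ∷ sΣ) with boxView i F
  ... | boxed _   = ⊥-elim (s refl)
  ... | unboxed _ = boxes-modal-conclusion i sΣ
  boxes-modal-conclusion i {[]} {[]} [] = refl
  boxes-modal-conclusion i {[]} {A ∷ Θ} [] with boxView i (□ i A)
  ... | boxed _    = cong (A ∷_) (boxes-modal-conclusion i [])
  ... | unboxed ≢□ = ⊥-elim (≢□ A refl)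

  modal-premise-boxes : ∀ i Π Γ {Σ Θ} → All (SigmaOK i) Σ → Σ ++ map (□ i) Θ ↭ Π ++ Γ →
                        Θ ↭ boxes i Π ++ boxes i Γ
  modal-premise-boxes i Π Γ {Σ} {Θ} sΣ σ = begin
    Θ                           ≡⟨ boxes-modal-conclusion i sΣ ⟨
    boxes i (Σ ++ map (□ i) Θ)  ↭⟨ mapMaybe-↭ (unbox i) σ ⟩
    boxes i (Π ++ Γ)            ≡⟨ List.mapMaybe-++ (unbox i) Π Γ ⟩
    boxes i Π ++ boxes i Γ      ∎
    where open PermutationReasoning

module _ {k : ℕ} (i : Fin k) where

  boxed-premise : ∀ Γ {Δ Δ₁} E → Δ ↭ map (□ i) E ++ Δ₁ → ∃ λ W → Γ ++ Δ ↭ W ++ map (□ i) (boxes i Γ ++ E)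
  boxed-premise Γ {Δ} {Δ₁} E δσ with W , γσ ← boxes-split i Γ = W ++ Δ₁ , (begin
    Γ ++ Δ                                   ↭⟨ ++⁺ γσ δσ ⟩
    (W ++ □B) ++ □E ++ Δ₁                    ≡⟨ List.++-assoc W □B (□E ++ Δ₁) ⟩
    W ++ □B ++ □E ++ Δ₁                      ↭⟨ ++⁺ˡ W (shifts □B □E) ⟩
    W ++ □E ++ □B ++ Δ₁                      ↭⟨ ++⁺ˡ W (++⁺ˡ □E (++-comm □B Δ₁)) ⟩
    W ++ □E ++ Δ₁ ++ □B                      ↭⟨ ++⁺ˡ W (shifts □E Δ₁) ⟩
    W ++ Δ₁ ++ □E ++ □B                      ≡⟨ List.++-assoc W Δ₁ (□E ++ □B) ⟨
    (W ++ Δ₁) ++ □E ++ □B                    ↭⟨ ++⁺ˡ (W ++ Δ₁) (++-comm □E □B) ⟩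
    (W ++ Δ₁) ++ □B ++ □E                    ≡⟨ cong ((W ++ Δ₁) ++_) (List.map-++ (□ i) (boxes i Γ) E) ⟨
    (W ++ Δ₁) ++ map (□ i) (boxes i Γ ++ E)  ∎)
    where
    open PermutationReasoning
    □B = map (□ i) (boxes i Γ)
    □E = map (□ i) E

  □-heavier : ∀ X → weight X ≤ weight (map (□ i) X)
  □-heavier []      = z≤n
  □-heavier (A ∷ X) = ≤-trans (+-monoʳ-≤ (size A) (□-heavier X)) (n≤1+n _)

  boxed-lighter : ∀ X {W Z} → X ≢ [] → Z ↭ W ++ map (□ i) X → weight X < weight Z
  boxed-lighter []      X≢[] _ = ⊥-elim (X≢[] refl)
  boxed-lighter (A ∷ X) {W} {Z} _ σ = begin-strict
    weight (A ∷ X)        <⟨ s≤s (+-monoʳ-≤ (size A) (□-heavier X)) ⟩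
    weight □X             ≤⟨ m≤n+m (weight □X) (weight W) ⟩
    weight W + weight □X  ≡⟨ weight-++ W □X ⟨
    weight (W ++ □X)      ≡⟨ weight-↭ σ ⟨
    weight Z              ∎
    where
    open ≤-Reasoning
    □X = map (□ i) (A ∷ X)

  boxed-vocabulary : ∀ X {W Z} → Z ↭ W ++ map (□ i) X → Vs X ⊆ Vs Z
  boxed-vocabulary X {W} {Z} σ = begin
    Vs X                   ≡⟨ List.concatMap-map V (□ i) X ⟨
    Vs (map (□ i) X)       ⊆⟨ Vs-mono (⊆.xs⊆ys++xs _ W) ⟩
    Vs (W ++ map (□ i) X)  ⊆⟨ Vs-↭ (↭-sym σ) ⟩
    Vs Z                   ∎
    where open ⊆.⊆-Reasoning ℕ

  modal-premise-lighter : ∀ Γ {Δ Δ₁} E → Δ ↭ map (□ i) E ++ Δ₁ → boxes i Γ ++ E ≢ [] →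
                          weight (boxes i Γ ++ E) < weight (Γ ++ Δ)
  modal-premise-lighter Γ E δσ nonempty =
    boxed-lighter (boxes i Γ ++ E) nonempty (proj₂ (boxed-premise Γ E δσ))

  modal-premise-vocabulary : ∀ Γ {Δ Δ₁} E → Δ ↭ map (□ i) E ++ Δ₁ → Vs (boxes i Γ ++ E) ⊆ Vs (Γ ++ Δ)
  modal-premise-vocabulary Γ E δσ = boxed-vocabulary (boxes i Γ ++ E) (proj₂ (boxed-premise Γ E δσ))

  boxed-antecedent : ∀ Θ {Γ W} → Γ ↭ W ++ map (□ i) (boxes i Γ) →
                     W ++ map (□ i) (Θ ++ boxes i Γ) ↭ map (□ i) Θ ++ Γ
  boxed-antecedent Θ {Γ} {W} σ = begin
    W ++ map (□ i) (Θ ++ boxes i Γ)            ≡⟨ cong (W ++_) (List.map-++ (□ i) Θ (boxes i Γ)) ⟩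
    W ++ map (□ i) Θ ++ map (□ i) (boxes i Γ)  ↭⟨ shifts W (map (□ i) Θ) ⟩
    map (□ i) Θ ++ W ++ map (□ i) (boxes i Γ)  ↭⟨ ++⁺ˡ (map (□ i) Θ) (↭-sym σ) ⟩
    map (□ i) Θ ++ Γ                           ∎
    where open PermutationReasoning

  □-intro : ∀ {L} Θ {Γ Δ A} → G L (Θ ++ boxes i Γ) (A ∷ []) → G L (map (□ i) Θ ++ Γ) (□ i A ∷ Δ)
  □-intro Θ {Γ} {Δ} d with W , σ ← boxes-split i Γ =
    weaken W Δ (□K i [] [] d) (boxed-antecedent Θ σ) (++-comm Δ _)

  □D-intro : ∀ {L} Θ {Γ Δ} → L ≡ KDn → Θ ++ boxes i Γ ≢ [] → G L (Θ ++ boxes i Γ) [] →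
             G L (map (□ i) Θ ++ Γ) Δ
  □D-intro Θ {Γ} {Δ} e nonempty d with W , σ ← boxes-split i Γ =
    weaken W Δ (□D i e nonempty [] [] d) (boxed-antecedent Θ σ) (↭-reflexive (List.++-identityʳ Δ))

-- Propositional rules

Sequent : ℕ → Set
Sequent k = List (Fm k) × List (Fm k)

module _ {k : ℕ} where

  infixr 5 _++ₛ_
  infix  4 _⊢_

  _++ₛ_ : Sequent k → Sequent k → Sequent k
  (Γ , Δ) ++ₛ (Γ′ , Δ′) = Γ ++ Γ′ , Δ ++ Δ′

  _⊢_ : Logic → Sequent k → Set
  L ⊢ (Γ , Δ) = G L Γ Δ

  formulas : Sequent k → List (Fm k)
  formulas (Γ , Δ) = Γ ++ Δ

  formulas-++ₛ : ∀ P S → formulas (P ++ₛ S) ↭ formulas P ++ formulas S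
  formulas-++ₛ (E₁ , E₂) (Γ , Δ) = begin
    (E₁ ++ Γ) ++ E₂ ++ Δ  ≡⟨ List.++-assoc E₁ Γ (E₂ ++ Δ) ⟩
    E₁ ++ Γ ++ E₂ ++ Δ    ↭⟨ ++⁺ˡ E₁ (shifts Γ E₂) ⟩
    E₁ ++ E₂ ++ Γ ++ Δ    ≡⟨ List.++-assoc E₁ E₂ (Γ ++ Δ) ⟨
    (E₁ ++ E₂) ++ Γ ++ Δ  ∎
    where open PermutationReasoning

  -- The instances (at most one) of the rule introducing F on the left, resp. right.  An instance
  -- is the list of its premises, each given by the formulas P it adds to the context S of the
  -- conclusion, so that the premise is P ++ₛ S.
  leftRules rightRules : Fm k → List (List (Sequent k))
  leftRules (A ∧′ B)  = ((A ∷ B ∷ [] , []) ∷ []) ∷ []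
  leftRules (A ∨′ B)  = ((A ∷ [] , []) ∷ (B ∷ [] , []) ∷ []) ∷ []
  leftRules (A ⇒′ B)  = (([] , A ∷ []) ∷ (B ∷ [] , []) ∷ []) ∷ []
  leftRules (¬′ A)    = (([] , A ∷ []) ∷ []) ∷ []
  leftRules _         = []
  rightRules (A ∧′ B) = (([] , A ∷ []) ∷ ([] , B ∷ []) ∷ []) ∷ []
  rightRules (A ∨′ B) = (([] , A ∷ B ∷ []) ∷ []) ∷ []
  rightRules (A ⇒′ B) = ((A ∷ [] , B ∷ []) ∷ []) ∷ []
  rightRules (¬′ A)   = ((A ∷ [] , []) ∷ []) ∷ []
  rightRules _        = []

  leftRules-sound : ∀ {L} F {Γ Δ} →
                    All (λ Ps → All (λ P → L ⊢ P ++ₛ (Γ , Δ)) Ps → G L (F ∷ Γ) Δ) (leftRules F)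
  leftRules-sound (A ∧′ B) = (λ { (d ∷ []) → L∧ d }) ∷ []
  leftRules-sound (A ∨′ B) = (λ { (d ∷ e ∷ []) → L∨ d e }) ∷ []
  leftRules-sound (A ⇒′ B) = (λ { (d ∷ e ∷ []) → L⇒ d e }) ∷ []
  leftRules-sound (¬′ A)   = (λ { (d ∷ []) → L¬ d }) ∷ []
  leftRules-sound (var _)  = []
  leftRules-sound ⊥′       = []
  leftRules-sound (□ _ _)  = []

  rightRules-sound : ∀ {L} F {Γ Δ} →
                     All (λ Ps → All (λ P → L ⊢ P ++ₛ (Γ , Δ)) Ps → G L Γ (F ∷ Δ)) (rightRules F)
  rightRules-sound (A ∧′ B) = (λ { (d ∷ e ∷ []) → R∧ d e }) ∷ []
  rightRules-sound (A ∨′ B) = (λ { (d ∷ []) → R∨ d }) ∷ []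
  rightRules-sound (A ⇒′ B) = (λ { (d ∷ []) → R⇒ d }) ∷ []
  rightRules-sound (¬′ A)   = (λ { (d ∷ []) → R¬ d }) ∷ []
  rightRules-sound (var _)  = []
  rightRules-sound ⊥′       = []
  rightRules-sound (□ _ _)  = []

  record Reduces (F : Fm k) (P : Sequent k) : Set where
    constructor reduces
    field
      lighter    : weight (formulas P) < size F
      vocabulary : Vs (formulas P) ⊆ V F

  private
    both : ∀ (A B : Fm k) → weight (A ∷ B ∷ []) < suc (size A + size B) × Vs (A ∷ B ∷ []) ⊆ V A ++ V B
    both A B = s≤s (≤-reflexive (cong (size A +_) (+-identityʳ (size B))))
             , ⊆.⊆-reflexive (cong (V A ++_) (List.++-identityʳ (V B)))

    first : ∀ (A B : Fm k) → weight (A ∷ []) < suc (size A + size B) × Vs (A ∷ []) ⊆ V A ++ V B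
    first A B = s≤s (≤-trans (≤-reflexive (+-identityʳ (size A))) (m≤m+n _ _)) , ⊆.++⁺ʳ (V A) (λ ())

    second : ∀ (A B : Fm k) → weight (B ∷ []) < suc (size A + size B) × Vs (B ∷ []) ⊆ V A ++ V B
    second A B = s≤s (≤-trans (≤-reflexive (+-identityʳ (size B))) (m≤n+m _ _))
               , ⊆.⊆-trans (⊆.⊆-reflexive (List.++-identityʳ (V B))) (⊆.xs⊆ys++xs (V B) (V A))

    only : ∀ (A : Fm k) → weight (A ∷ []) < suc (size A) × Vs (A ∷ []) ⊆ V A
    only A = s≤s (≤-reflexive (+-identityʳ (size A))) , ⊆.⊆-reflexive (List.++-identityʳ (V A))

  leftRules-reduce : ∀ F → All (All (Reduces F)) (leftRules F)
  leftRules-reduce (A ∧′ B) = (uncurry reduces (both A B) ∷ []) ∷ []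
  leftRules-reduce (A ∨′ B) = (uncurry reduces (first A B) ∷ uncurry reduces (second A B) ∷ []) ∷ []
  leftRules-reduce (A ⇒′ B) = (uncurry reduces (first A B) ∷ uncurry reduces (second A B) ∷ []) ∷ []
  leftRules-reduce (¬′ A)   = (uncurry reduces (only A) ∷ []) ∷ []
  leftRules-reduce (var _)  = []
  leftRules-reduce ⊥′       = []
  leftRules-reduce (□ _ _)  = []

  rightRules-reduce : ∀ F → All (All (Reduces F)) (rightRules F)
  rightRules-reduce (A ∧′ B) = (uncurry reduces (first A B) ∷ uncurry reduces (second A B) ∷ []) ∷ []
  rightRules-reduce (A ∨′ B) = (uncurry reduces (both A B) ∷ []) ∷ []
  rightRules-reduce (A ⇒′ B) = (uncurry reduces (both A B) ∷ []) ∷ []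
  rightRules-reduce (¬′ A)   = (uncurry reduces (only A) ∷ []) ∷ []
  rightRules-reduce (var _)  = []
  rightRules-reduce ⊥′       = []
  rightRules-reduce (□ _ _)  = []

  premise-lighter : ∀ S {X F P} → X ↭ F ∷ formulas S → Reduces F P → weight (formulas (P ++ₛ S)) < weight X
  premise-lighter S {X} {F} {P} σ (reduces lighter _) = begin-strict
    weight (formulas (P ++ₛ S))                ≡⟨ weight-↭ (formulas-++ₛ P S) ⟩
    weight (formulas P ++ formulas S)          ≡⟨ weight-++ (formulas P) (formulas S) ⟩
    weight (formulas P) + weight (formulas S)  <⟨ +-monoˡ-< (weight (formulas S)) lighter ⟩
    size F + weight (formulas S)               ≡⟨ weight-↭ σ ⟨
    weight X                                   ∎
    where open ≤-Reasoning

  premise-vocabulary : ∀ S {X F P} → X ↭ F ∷ formulas S → Reduces F P → Vs (formulas (P ++ₛ S)) ⊆ Vs X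
  premise-vocabulary S {X} {F} {P} σ (reduces _ sub) = begin
    Vs (formulas (P ++ₛ S))             ⊆⟨ Vs-↭ (formulas-++ₛ P S) ⟩
    Vs (formulas P ++ formulas S)       ≡⟨ Vs-++ (formulas P) (formulas S) ⟩
    Vs (formulas P) ++ Vs (formulas S)  ⊆⟨ ⊆.++⁺ˡ (Vs (formulas S)) sub ⟩
    V F ++ Vs (formulas S)              ⊆⟨ Vs-↭ (↭-sym σ) ⟩
    Vs X                                ∎
    where open ⊆.⊆-Reasoning ℕ

  principalˡ-front : ∀ {F : Fm k} {Γ r Δ} → Γ ↭ F ∷ r → Γ ++ Δ ↭ F ∷ r ++ Δ
  principalˡ-front {Δ = Δ} γσ = ++⁺ʳ Δ γσ

  principalʳ-front : ∀ {F : Fm k} {Γ Δ r} → Δ ↭ F ∷ r → Γ ++ Δ ↭ F ∷ Γ ++ r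
  principalʳ-front {F} {Γ} {r = r} δσ = trans (++⁺ˡ Γ δσ) (shift F Γ r)

-- The interpolant

module _ {k : ℕ} (p : ℕ) where

  atomicˡ : Fm k → List (Fm k)
  atomicˡ (var q) = (¬′ var q) if ¬? (q ℕ.≟ p)
  atomicˡ ⊥′      = ⊤′ ∷ []
  atomicˡ _       = []

  module _ (f : Sequent k → Fm k) where

    premiseConj : Sequent k → List (Sequent k) → Fm k
    premiseConj S Ps = ⋀ (map (λ P → f (P ++ₛ S)) Ps)

    -- ⊤ accounts for initial sequents lying within Γ ⇒ Δ, also when q is p.
    atomicʳ : List (Fm k) → Fm k → List (Fm k)
    atomicʳ Γ (var q) = (⊤′ if any? (var≟ q) Γ) ++ (var q if ¬? (q ℕ.≟ p))
    atomicʳ Γ (□ i C) = □ i (f (boxes i Γ , C ∷ [])) ∷ []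
    atomicʳ Γ _       = []

    leftDisjuncts : List (Fm k) → Fm k × List (Fm k) → List (Fm k)
    leftDisjuncts Δ (F , r) = atomicˡ F ++ map (premiseConj (r , Δ)) (leftRules F)

    rightDisjuncts : List (Fm k) → Fm k × List (Fm k) → List (Fm k)
    rightDisjuncts Γ (F , r) = atomicʳ Γ F ++ map (premiseConj (Γ , r)) (rightRules F)

    ◇-disjunct : List (Fm k) → Fin k → Fm k
    ◇-disjunct Γ i = ◇ i (f (boxes i Γ , []))

    disjuncts : Sequent k → List (Fm k)
    disjuncts (Γ , Δ) = concatMap (leftDisjuncts Δ) (picks Γ)
                     ++ concatMap (rightDisjuncts Γ) (picks Δ)
                     ++ map (◇-disjunct Γ) (allFin k)

    ∈-disjunctsˡ : ∀ {Γ Δ F r D} → (F , r) ∈ picks Γ → D ∈ leftDisjuncts Δ (F , r) → D ∈ disjuncts (Γ , Δ)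
    ∈-disjunctsˡ {Δ = Δ} F,r∈ D∈ = ∈-++⁺ˡ (∈-concatMap (leftDisjuncts Δ) F,r∈ D∈)

    ∈-disjunctsʳ : ∀ {Γ Δ F r D} → (F , r) ∈ picks Δ → D ∈ rightDisjuncts Γ (F , r) → D ∈ disjuncts (Γ , Δ)
    ∈-disjunctsʳ {Γ} {Δ} F,r∈ D∈ =
      ∈-++⁺ʳ (concatMap (leftDisjuncts Δ) (picks Γ)) (∈-++⁺ˡ (∈-concatMap (rightDisjuncts Γ) F,r∈ D∈))

    ∈-disjuncts◇ : ∀ {Γ Δ} i → ◇-disjunct Γ i ∈ disjuncts (Γ , Δ)
    ∈-disjuncts◇ {Γ} {Δ} i =
      ∈-++⁺ʳ (concatMap (leftDisjuncts Δ) (picks Γ))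
             (∈-++⁺ʳ (concatMap (rightDisjuncts Γ) (picks Δ)) (∈-map⁺ (◇-disjunct Γ) (∈-allFin i)))

  -- Fuel above weight (Γ ++ Δ) suffices: every recursive call is on a lighter sequent.
  interpolant : ℕ → Sequent k → Fm k
  interpolant zero    _ = ⊥′
  interpolant (suc n) S = ⋁ (disjuncts (interpolant n) S)

-- Properties (i) and (ii)

module _ {k : ℕ} (L : Logic) (p : ℕ) where

  record Allowed (X : List (Fm k)) (q : ℕ) : Set where
    constructor allowed
    field
      occurs : q ∈ Vs X
      ≢p     : q ≢ p

  Sound : Sequent k → Fm k → Set
  Sound (Γ , Δ) D = All (Allowed (Γ ++ Δ)) (V D) × G L (D ∷ Γ) Δ

  allowed-mono : ∀ {X Y qs} → Vs X ⊆ Vs Y → All (Allowed X) qs → All (Allowed Y) qs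
  allowed-mono X⊆Y = All.map λ (allowed q∈X q≢p) → allowed (X⊆Y q∈X) q≢p

  atomicˡ-sound : ∀ {Γ Δ F r} → Γ ↭ F ∷ r → All (Sound (Γ , Δ)) (atomicˡ p F)
  atomicˡ-sound {F = var q} γσ = if-All (¬? (q ℕ.≟ p)) λ q≢p →
    (allowed (V⊆Vs (∈-++⁺ˡ (↭⇒∈ γσ)) (here refl)) q≢p ∷ []) , L¬ (initial (↭⇒∈ γσ) (here refl))
  atomicˡ-sound {F = ⊥′}     γσ = ([] , weakenˡ ⊤′ (falsum (↭⇒∈ γσ))) ∷ []
  atomicˡ-sound {F = _ ∧′ _} _  = []
  atomicˡ-sound {F = _ ∨′ _} _  = []
  atomicˡ-sound {F = _ ⇒′ _} _  = []
  atomicˡ-sound {F = ¬′ _}   _  = []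
  atomicˡ-sound {F = □ _ _}  _  = []

  module _ {f : Sequent k → Fm k} (ih : ∀ S → Sound S (f S)) where

    premiseConj-allowed : ∀ S {X F Ps} → X ↭ F ∷ formulas S → All (Reduces F) Ps →
                          All (Allowed X) (V (premiseConj p f S Ps))
    premiseConj-allowed S σ reduce = V-⋀ (All.map⁺ (All.tabulate λ {P} P∈ →
      allowed-mono (premise-vocabulary S σ (All.lookup reduce P∈)) (proj₁ (ih (P ++ₛ S)))))

    premiseConj-premise : ∀ {S Ps P} → P ∈ Ps → L ⊢ P ++ₛ (premiseConj p f S Ps ∷ proj₁ S , proj₂ S)
    premiseConj-premise {S} {P = P} P∈ =
      perm (↭-sym (shift _ (proj₁ P) (proj₁ S))) refl (⋀ˡ (∈-map⁺ _ P∈) (proj₂ (ih (P ++ₛ S))))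

    leftDisjuncts-sound : ∀ {Γ Δ F r} → Γ ↭ F ∷ r → All (Sound (Γ , Δ)) (leftDisjuncts p f Δ (F , r))
    leftDisjuncts-sound {Δ = Δ} {F} {r} γσ = All.++⁺ (atomicˡ-sound γσ) (All.map⁺ (All.tabulate λ Ps∈ →
        premiseConj-allowed (r , Δ) (principalˡ-front γσ) (All.lookup (leftRules-reduce F) Ps∈)
      , perm (trans (swap _ _ refl) (prep _ (↭-sym γσ))) refl
             (All.lookup (leftRules-sound F) Ps∈ (All.tabulate premiseConj-premise))))

    atomicʳ-sound : ∀ {Γ Δ F r} → Δ ↭ F ∷ r → All (Sound (Γ , Δ)) (atomicʳ p f Γ F)
    atomicʳ-sound {Γ} {F = var q} δσ = All.++⁺
      (if-All (any? (var≟ q) Γ) λ q∈Γ → [] , weakenˡ ⊤′ (initial q∈Γ (↭⇒∈ δσ)))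
      (if-All (¬? (q ℕ.≟ p)) λ q≢p →
        (allowed (V⊆Vs (∈-++⁺ʳ Γ (↭⇒∈ δσ)) (here refl)) q≢p ∷ []) , initial (here refl) (↭⇒∈ δσ))
    atomicʳ-sound {Γ} {F = □ i C} δσ =
      ( allowed-mono (modal-premise-vocabulary i Γ (C ∷ []) δσ) (proj₁ (ih _))
      , perm refl (↭-sym δσ) (□-intro i (_ ∷ []) (proj₂ (ih (boxes i Γ , C ∷ []))))) ∷ []
    atomicʳ-sound {F = ⊥′}     _ = []
    atomicʳ-sound {F = _ ∧′ _} _ = []
    atomicʳ-sound {F = _ ∨′ _} _ = []
    atomicʳ-sound {F = _ ⇒′ _} _ = []
    atomicʳ-sound {F = ¬′ _}   _ = []

    rightDisjuncts-sound : ∀ {Γ Δ F r} → Δ ↭ F ∷ r → All (Sound (Γ , Δ)) (rightDisjuncts p f Γ (F , r))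
    rightDisjuncts-sound {Γ} {F = F} {r} δσ = All.++⁺ (atomicʳ-sound δσ) (All.map⁺ (All.tabulate λ Ps∈ →
        premiseConj-allowed (Γ , r) (principalʳ-front δσ) (All.lookup (rightRules-reduce F) Ps∈)
      , perm refl (↭-sym δσ) (All.lookup (rightRules-sound F) Ps∈ (All.tabulate premiseConj-premise))))

    ◇-disjunct-sound : ∀ {Γ Δ} i → Sound (Γ , Δ) (◇-disjunct p f Γ i)
    ◇-disjunct-sound {Γ} i = allowed-mono (modal-premise-vocabulary i Γ [] refl) (proj₁ (ih _))
                           , L¬ (□-intro i [] (R¬ (proj₂ (ih (boxes i Γ , [])))))

    disjuncts-sound : ∀ S → All (Sound S) (disjuncts p f S)
    disjuncts-sound (Γ , Δ) =
      All.++⁺ (all-concatMap _ λ F,r∈ → leftDisjuncts-sound (picks-↭ Γ F,r∈))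
      (All.++⁺ (all-concatMap _ λ F,r∈ → rightDisjuncts-sound (picks-↭ Δ F,r∈))
               (All.map⁺ (All.universal ◇-disjunct-sound (allFin k))))

  interpolant-sound : ∀ n S → Sound S (interpolant p n S)
  interpolant-sound zero    S = [] , ax⊥
  interpolant-sound (suc n) S = V-⋁ (All.map proj₁ sound) , ⋁ˡ (All.map proj₂ sound)
    where sound = disjuncts-sound (interpolant-sound n) S

-- Property (iii)

  Uniform : ℕ → Set
  Uniform n = ∀ (Γ Δ Π Λ : List (Fm k)) → weight (Γ ++ Δ) < n → ∀ {X Y} → G L X Y →
              X ↭ Π ++ Γ → Y ↭ Δ ++ Λ → p ∉ Vs (Π ++ Λ) → G L Π (interpolant p n (Γ , Δ) ∷ Λ)

  var-≢p : ∀ {q} {X : List (Fm k)} → var q ∈ X → p ∉ Vs X → q ≢ p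
  var-≢p q∈X p∉X refl = p∉X (V⊆Vs q∈X (here refl))

  module _ {n : ℕ} (Γ Δ : List (Fm k)) {Π Λ : List (Fm k)} where

    viaˡ : ∀ {F r D} → (F , r) ∈ picks Γ → D ∈ leftDisjuncts p (interpolant p n) Δ (F , r) →
           G L Π (D ∷ Λ) → G L Π (interpolant p (suc n) (Γ , Δ) ∷ Λ)
    viaˡ F,r∈ D∈ = ⋁ʳ (∈-disjunctsˡ p (interpolant p n) F,r∈ D∈)

    viaʳ : ∀ {F r D} → (F , r) ∈ picks Δ → D ∈ rightDisjuncts p (interpolant p n) Γ (F , r) →
           G L Π (D ∷ Λ) → G L Π (interpolant p (suc n) (Γ , Δ) ∷ Λ)
    viaʳ F,r∈ D∈ = ⋁ʳ (∈-disjunctsʳ p (interpolant p n) F,r∈ D∈)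

    via◇ : ∀ i → G L Π (◇-disjunct p (interpolant p n) Γ i ∷ Λ) → G L Π (interpolant p (suc n) (Γ , Δ) ∷ Λ)
    via◇ i = ⋁ʳ (∈-disjuncts◇ p (interpolant p n) {Γ} {Δ} i)

    via-atomicˡ : ∀ {F Γ₁ D} → Γ ↭ F ∷ Γ₁ → D ∈ atomicˡ p F →
                  G L Π (D ∷ Λ) → G L Π (interpolant p (suc n) (Γ , Δ) ∷ Λ)
    via-atomicˡ γσ D∈ with _ , F,r∈ , _ ← ↭⇒picks γσ = viaˡ F,r∈ (∈-++⁺ˡ D∈)

    via-atomicʳ : ∀ {F Δ₁ D} → Δ ↭ F ∷ Δ₁ → D ∈ atomicʳ p (interpolant p n) Γ F →
                  G L Π (D ∷ Λ) → G L Π (interpolant p (suc n) (Γ , Δ) ∷ Λ)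
    via-atomicʳ δσ D∈ with _ , F,r∈ , _ ← ↭⇒picks δσ = viaʳ F,r∈ (∈-++⁺ˡ D∈)

    byAxiom : ∀ {q X Y} → Split (var q) X Π Γ → Split (var q) Y Δ Λ → p ∉ Vs (Π ++ Λ) →
              G L Π (interpolant p (suc n) (Γ , Δ) ∷ Λ)
    byAxiom (inˡ _ πσ _) (inʳ _ λσ _) _  = weakenʳ _ (initial (↭⇒∈ πσ) (↭⇒∈ λσ))
    byAxiom (inˡ _ πσ _) (inˡ _ δσ _) np = via-atomicʳ δσ
      (∈-++⁺ʳ _ (if-∈ (¬? (_ ℕ.≟ p)) (var-≢p (∈-++⁺ˡ (↭⇒∈ πσ)) np))) (initial (↭⇒∈ πσ) (here refl))
    byAxiom (inʳ _ γσ _) (inʳ _ λσ _) np = via-atomicˡ γσ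
      (if-∈ (¬? (_ ℕ.≟ p)) (var-≢p (∈-++⁺ʳ Π (↭⇒∈ λσ)) np)) (R¬ (initial (here refl) (↭⇒∈ λσ)))
    byAxiom (inʳ _ γσ _) (inˡ _ δσ _) _  = via-atomicʳ δσ (∈-++⁺ˡ (if-∈ (any? (var≟ _) Γ) (↭⇒∈ γσ))) (R¬ ax⊥)

    byFalsum : ∀ {X} → Split ⊥′ X Π Γ → G L Π (interpolant p (suc n) (Γ , Δ) ∷ Λ)
    byFalsum (inˡ _ πσ _) = falsum (↭⇒∈ πσ)
    byFalsum (inʳ _ γσ _) = via-atomicˡ γσ (here refl) (R¬ ax⊥)

  contextLeftRule : ∀ {I : Fm k} {F Π Π₁ Λ Ps} → Π ↭ F ∷ Π₁ → p ∉ Vs (Π ++ Λ) → Ps ∈ leftRules F →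
                    All (λ P → p ∉ Vs (formulas (P ++ₛ (Π₁ , Λ))) →
                               G L (proj₁ P ++ Π₁) (I ∷ proj₂ P ++ Λ)) Ps →
                    G L Π (I ∷ Λ)
  contextLeftRule {I} {F} {Π} {Π₁} {Λ} {Ps} πσ np Ps∈ ihs =
    perm (↭-sym πσ) refl (All.lookup (leftRules-sound F) Ps∈ (All.tabulate λ {P} P∈ →
      perm refl (↭-sym (shift I (proj₂ P) Λ)) (All.lookup ihs P∈ (np ∘ vocabulary P∈))))
    where
    vocabulary : ∀ {P} → P ∈ Ps → Vs (formulas (P ++ₛ (Π₁ , Λ))) ⊆ Vs (Π ++ Λ)
    vocabulary P∈ = premise-vocabulary (Π₁ , Λ) (principalˡ-front πσ)
                                       (All.lookup (All.lookup (leftRules-reduce F) Ps∈) P∈)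

  contextRightRule : ∀ {I : Fm k} {F Π Λ Λ₁ Ps} → Λ ↭ F ∷ Λ₁ → p ∉ Vs (Π ++ Λ) → Ps ∈ rightRules F →
                     All (λ P → p ∉ Vs (formulas (P ++ₛ (Π , Λ₁))) →
                                G L (proj₁ P ++ Π) (I ∷ proj₂ P ++ Λ₁)) Ps →
                     G L Π (I ∷ Λ)
  contextRightRule {I} {F} {Π} {Λ} {Λ₁} {Ps} λσ np Ps∈ ihs =
    perm refl (trans (swap _ _ refl) (prep I (↭-sym λσ)))
      (All.lookup (rightRules-sound F) Ps∈ (All.tabulate λ {P} P∈ →
        perm refl (↭-sym (shift I (proj₂ P) Λ₁)) (All.lookup ihs P∈ (np ∘ vocabulary P∈))))
    where
    vocabulary : ∀ {P} → P ∈ Ps → Vs (formulas (P ++ₛ (Π , Λ₁))) ⊆ Vs (Π ++ Λ)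
    vocabulary P∈ = premise-vocabulary (Π , Λ₁) (principalʳ-front λσ)
                                       (All.lookup (All.lookup (rightRules-reduce F) Ps∈) P∈)

  -- The fuel is a parameter here, so `step` recurses on derivations only: recursing on fuel and
  -- derivation in one function is rejected, as the with-clauses hide that the fuel is unchanged.
  module _ {m : ℕ} (ih : Uniform m) where

   module _ (Γ Δ : List (Fm k)) {Π Λ : List (Fm k)} (w : weight (Γ ++ Δ) < suc m) where

    byLeftRule : ∀ {F Γ₁ X Y Ps} → Γ ↭ F ∷ Γ₁ → X ↭ Π ++ Γ₁ → Y ↭ Δ ++ Λ → p ∉ Vs (Π ++ Λ) →
                 Ps ∈ leftRules F → All (λ P → G L (proj₁ P ++ X) (proj₂ P ++ Y)) Ps →
                 G L Π (interpolant p (suc m) (Γ , Δ) ∷ Λ)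
    byLeftRule {F} {Ps = Ps} γσ ρ τ np Ps∈ ds with r , F,r∈ , r↭Γ₁ ← ↭⇒picks γσ =
      viaˡ {m} Γ Δ F,r∈ (∈-++⁺ʳ (atomicˡ p F) (∈-map⁺ _ Ps∈)) (⋀ʳ (All.map⁺ (All.tabulate λ {P} P∈ →
        ih _ _ Π Λ (lighter P∈) (All.lookup ds P∈) (joinʳ (proj₁ P) Π r ρ′) (joinˡ (proj₂ P) Δ Λ τ) np)))
      where
      ρ′ = trans ρ (++⁺ˡ Π (↭-sym r↭Γ₁))
      lighter : ∀ {P} → P ∈ Ps → weight (formulas (P ++ₛ (r , Δ))) < m
      lighter P∈ = <-≤-trans
        (premise-lighter (r , Δ) (principalˡ-front (trans γσ (prep F (↭-sym r↭Γ₁))))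
                         (All.lookup (All.lookup (leftRules-reduce F) Ps∈) P∈))
        (≤-pred w)

    byRightRule : ∀ {F Δ₁ X Y Ps} → Δ ↭ F ∷ Δ₁ → X ↭ Π ++ Γ → Y ↭ Δ₁ ++ Λ → p ∉ Vs (Π ++ Λ) →
                  Ps ∈ rightRules F → All (λ P → G L (proj₁ P ++ X) (proj₂ P ++ Y)) Ps →
                  G L Π (interpolant p (suc m) (Γ , Δ) ∷ Λ)
    byRightRule {F} {Ps = Ps} δσ σ ρ np Ps∈ ds with r , F,r∈ , r↭Δ₁ ← ↭⇒picks δσ =
      viaʳ {m} Γ Δ F,r∈ (∈-++⁺ʳ (atomicʳ p _ Γ F) (∈-map⁺ _ Ps∈)) (⋀ʳ (All.map⁺ (All.tabulate λ {P} P∈ →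
        ih _ _ Π Λ (lighter P∈) (All.lookup ds P∈) (joinʳ (proj₁ P) Π Γ σ) (joinˡ (proj₂ P) r Λ ρ′) np)))
      where
      ρ′ = trans ρ (++⁺ʳ Λ (↭-sym r↭Δ₁))
      lighter : ∀ {P} → P ∈ Ps → weight (formulas (P ++ₛ (Γ , r))) < m
      lighter P∈ = <-≤-trans
        (premise-lighter (Γ , r) (principalʳ-front (trans δσ (prep F (↭-sym r↭Δ₁))))
                         (All.lookup (All.lookup (rightRules-reduce F) Ps∈) P∈))
        (≤-pred w)

    byBox : ∀ {i C Δ₁ Θ} → Δ ↭ □ i C ∷ Δ₁ → Θ ↭ boxes i Π ++ boxes i Γ → G L Θ (C ∷ []) → p ∉ Vs (Π ++ Λ) →
            G L Π (interpolant p (suc m) (Γ , Δ) ∷ Λ)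
    byBox {i} {C} δσ θσ d np = via-atomicʳ {m} Γ Δ δσ (here refl) (□-intro i []
      (ih (boxes i Γ) (C ∷ []) (boxes i Π) [] lighter d θσ refl (np ∘ modal-premise-vocabulary i Π [] refl)))
      where
      nonempty = (λ ()) ∘ List.++-conicalʳ (boxes i Γ) (C ∷ [])
      lighter  = <-≤-trans (modal-premise-lighter i Γ (C ∷ []) δσ nonempty) (≤-pred w)

    ◇-lighter : ∀ i → boxes i Γ ≢ [] → weight (boxes i Γ ++ []) < m
    ◇-lighter i nonempty =
      <-≤-trans (modal-premise-lighter i Γ [] refl (nonempty ∘ List.++-conicalˡ _ [])) (≤-pred w)

    byBoxInContext : ∀ {i C Λ₁ Θ} → Λ ↭ □ i C ∷ Λ₁ → Θ ↭ boxes i Π ++ boxes i Γ → G L Θ (C ∷ []) →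
                     p ∉ Vs (Π ++ Λ) → G L Π (interpolant p (suc m) (Γ , Δ) ∷ Λ)
    byBoxInContext {i} {C} λσ θσ d np with empty? (boxes i Γ)
    ... | inj₁ none = perm refl (prep _ (↭-sym λσ)) (weakenʳ _ (□-intro i [] (perm θσ′ refl d)))
      where θσ′ = trans θσ (↭-reflexive (≡.trans (cong (boxes i Π ++_) none) (List.++-identityʳ _)))
    ... | inj₂ some = via◇ {m} Γ Δ i (R¬ (perm refl (↭-sym λσ) (□-intro i (_ ∷ []) (L¬
      (ih (boxes i Γ) [] (boxes i Π) (C ∷ []) (◇-lighter i some) d θσ refl
          (np ∘ modal-premise-vocabulary i Π (C ∷ []) λσ))))))

    bySeriality : ∀ {i Θ} → L ≡ KDn → Θ ≢ [] → Θ ↭ boxes i Π ++ boxes i Γ → G L Θ [] → p ∉ Vs (Π ++ Λ) →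
                  G L Π (interpolant p (suc m) (Γ , Δ) ∷ Λ)
    bySeriality {i} e Θ≢[] θσ d np with empty? (boxes i Γ)
    ... | inj₁ none =
      weakenʳ _ (□D-intro i [] e (Θ≢[] ∘ ↭-empty-inv ∘ trans θσ′ ∘ ↭-reflexive) (perm θσ′ refl d))
      where θσ′ = trans θσ (↭-reflexive (≡.trans (cong (boxes i Π ++_) none) (List.++-identityʳ _)))
    ... | inj₂ some = via◇ {m} Γ Δ i (R¬ (□D-intro i (_ ∷ []) e (λ ()) (L¬
      (ih (boxes i Γ) [] (boxes i Π) [] (◇-lighter i some) d θσ refl
          (np ∘ modal-premise-vocabulary i Π [] refl)))))

   step : Uniform (suc m)
   step Γ Δ Π Λ w (perm σ′ τ′ d) σ τ np = step Γ Δ Π Λ w d (trans σ′ σ) (trans τ′ τ) np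
   step Γ Δ Π Λ w (ax q) σ τ np = byAxiom {m} Γ Δ (split Π Γ σ) (split Δ Λ τ) np
   step Γ Δ Π Λ w ax⊥    σ τ np = byFalsum {m} Γ Δ (split Π Γ σ)
   step Γ Δ Π Λ w (L∧ d) σ τ np with split Π Γ σ
   ... | inˡ Π₁ πσ ρ = contextLeftRule πσ np (here refl)
                         (step Γ Δ (_ ∷ _ ∷ Π₁) Λ w d (prep _ (prep _ ρ)) τ ∷ [])
   ... | inʳ _  γσ ρ = byLeftRule Γ Δ w γσ ρ τ np (here refl) (d ∷ [])
   step Γ Δ Π Λ w (L∨ d e) σ τ np with split Π Γ σ
   ... | inˡ Π₁ πσ ρ = contextLeftRule πσ np (here refl)
                         (step Γ Δ (_ ∷ Π₁) Λ w d (prep _ ρ) τ ∷ step Γ Δ (_ ∷ Π₁) Λ w e (prep _ ρ) τ ∷ [])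
   ... | inʳ _  γσ ρ = byLeftRule Γ Δ w γσ ρ τ np (here refl) (d ∷ e ∷ [])
   step Γ Δ Π Λ w (L⇒ d e) σ τ np with split Π Γ σ
   ... | inˡ Π₁ πσ ρ = contextLeftRule πσ np (here refl)
                         (step Γ Δ Π₁ (_ ∷ Λ) w d ρ (joinʳ (_ ∷ []) Δ Λ τ)
                        ∷ step Γ Δ (_ ∷ Π₁) Λ w e (prep _ ρ) τ ∷ [])
   ... | inʳ _  γσ ρ = byLeftRule Γ Δ w γσ ρ τ np (here refl) (d ∷ e ∷ [])
   step Γ Δ Π Λ w (L¬ d) σ τ np with split Π Γ σ
   ... | inˡ Π₁ πσ ρ = contextLeftRule πσ np (here refl)
                         (step Γ Δ Π₁ (_ ∷ Λ) w d ρ (joinʳ (_ ∷ []) Δ Λ τ) ∷ [])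
   ... | inʳ _  γσ ρ = byLeftRule Γ Δ w γσ ρ τ np (here refl) (d ∷ [])
   step Γ Δ Π Λ w (R∧ d e) σ τ np with split Δ Λ τ
   ... | inˡ _  δσ ρ = byRightRule Γ Δ w δσ σ ρ np (here refl) (d ∷ e ∷ [])
   ... | inʳ Λ₁ λσ ρ = contextRightRule λσ np (here refl)
                         (step Γ Δ Π (_ ∷ Λ₁) w d σ (joinʳ (_ ∷ []) Δ Λ₁ ρ)
                        ∷ step Γ Δ Π (_ ∷ Λ₁) w e σ (joinʳ (_ ∷ []) Δ Λ₁ ρ) ∷ [])
   step Γ Δ Π Λ w (R∨ d) σ τ np with split Δ Λ τ
   ... | inˡ _  δσ ρ = byRightRule Γ Δ w δσ σ ρ np (here refl) (d ∷ [])
   ... | inʳ Λ₁ λσ ρ = contextRightRule λσ np (here refl)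
                         (step Γ Δ Π (_ ∷ _ ∷ Λ₁) w d σ (joinʳ (_ ∷ _ ∷ []) Δ Λ₁ ρ) ∷ [])
   step Γ Δ Π Λ w (R⇒ d) σ τ np with split Δ Λ τ
   ... | inˡ _  δσ ρ = byRightRule Γ Δ w δσ σ ρ np (here refl) (d ∷ [])
   ... | inʳ Λ₁ λσ ρ = contextRightRule λσ np (here refl)
                         (step Γ Δ (_ ∷ Π) (_ ∷ Λ₁) w d (prep _ σ) (joinʳ (_ ∷ []) Δ Λ₁ ρ) ∷ [])
   step Γ Δ Π Λ w (R¬ d) σ τ np with split Δ Λ τ
   ... | inˡ _  δσ ρ = byRightRule Γ Δ w δσ σ ρ np (here refl) (d ∷ [])
   ... | inʳ Λ₁ λσ ρ = contextRightRule λσ np (here refl) (step Γ Δ (_ ∷ Π) Λ₁ w d (prep _ σ) ρ ∷ [])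
   step Γ Δ Π Λ w (□K i sΣ _ d) σ τ np with split Δ Λ τ
   ... | inˡ _ δσ _ = byBox Γ Δ w δσ (modal-premise-boxes i Π Γ sΣ σ) d np
   ... | inʳ _ λσ _ = byBoxInContext Γ Δ w λσ (modal-premise-boxes i Π Γ sΣ σ) d np
   step Γ Δ Π Λ w (□D i e Θ≢[] sΣ _ d) σ τ np = bySeriality Γ Δ w e Θ≢[] (modal-premise-boxes i Π Γ sΣ σ) d np

  uniform : ∀ n → Uniform n
  uniform zero    = λ _ _ _ _ ()
  uniform (suc m) = step (uniform m)

theorem3p19 : ∀ {k : ℕ} (L : Logic) (Γ Δ : List (Fm k)) (p : ℕ) →
    Σ (Fm k) λ A →
      (∀ q → q ∈ V A → (q ∈ Vs (Γ ++ Δ)) × (q ≢ p))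
      × G L (A ∷ Γ) Δ
      × (∀ (Π Λ : List (Fm k)) → p ∉ Vs (Π ++ Λ) →
           G L (Π ++ Γ) (Δ ++ Λ) → G L Π (A ∷ Λ))
theorem3p19 L Γ Δ p =
    interpolant p fuel (Γ , Δ)
  , (λ q q∈A → let allowed q∈Γ,Δ q≢p = All.lookup (proj₁ sound) q∈A in q∈Γ,Δ , q≢p)
  , proj₂ sound
  , λ Π Λ p∉Π,Λ d → uniform L p fuel Γ Δ Π Λ (n<1+n _) d refl refl p∉Π,Λ
  where
  fuel  = suc (weight (Γ ++ Δ))
  sound = interpolant-sound L p fuel (Γ , Δ)
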